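{- Let $k\ge 2$ and let $G$ be a $k$-connected equimatchable factor-critical graph with a vertex cut $S$ of size $k$. If $G$ has at least $2k+3$ vertices, then $G-S$ has precisely two components.
   Context: All graphs are finite, simple and undirected. A graph is equimatchable if every maximal matching is a maximum matching. A graph is factor-critical if $G-v$ has a perfect matching for every vertex $v$. -}

module Defs where

open import Data.Nat using (ℕ; _+_; _*_; _<_; _≤_; _>_)
open import Data.Fin using (Fin)
open import Data.Fin.Subset using (Subset; _∈_; _∉_; ∣_∣)
open import Data.List using (List; map; allFin)
open import Data.Nat.ListAction using (sum)
open import Data.Maybe using (Maybe; just; nothing; is-just)
open import Data.Bool using (if_then_else_)
open import Data.Product using (Σ; _×_; ∃; ∃-syntax)
open import Data.Sum using (_⊎_)
open import Relation.Nullary using (¬_; Dec)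
open import Relation.Binary.PropositionalEquality using (_≡_; _≢_)

record Graph (n : ℕ) : Set₁ where
  field
    Adj     : Fin n → Fin n → Set
    adj?    : ∀ u v → Dec (Adj u v)
    sym     : ∀ {u v} → Adj u v → Adj v u
    irrefl  : ∀ {u} → ¬ Adj u u
open Graph public

module _ {n : ℕ} (G : Graph n) where

  -- A matching, given as its partner function: partner u ≡ just v means
  -- uv is an edge of the matching.  Each vertex lies in at most one
  -- matching edge by construction.
  IsMatching : (Fin n → Maybe (Fin n)) → Set
  IsMatching p = ∀ u v → p u ≡ just v → Adj G u v × p v ≡ just u

  record Matching : Set where
    field
      partner    : Fin n → Maybe (Fin n)
      isMatching : IsMatching partner
  open Matching public

  -- number of vertices covered by a matching (= 2 * number of its edges)
  covered : Matching → ℕ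
  covered M = sum (map (λ u → if is-just (partner M u) then 1 else 0) (allFin n))

  _⊆ᴹ_ : Matching → Matching → Set
  M ⊆ᴹ M' = ∀ u v → partner M u ≡ just v → partner M' u ≡ just v

  IsMaximal : Matching → Set
  IsMaximal M = ∀ M' → M ⊆ᴹ M' → M' ⊆ᴹ M

  IsMaximum : Matching → Set
  IsMaximum M = ∀ M' → covered M' ≤ covered M

  Equimatchable : Set
  Equimatchable = ∀ M → IsMaximal M → IsMaximum M

  -- G - v has a perfect matching for every vertex v: a matching of G
  -- that leaves exactly v uncovered.
  FactorCritical : Set
  FactorCritical = ∀ v → Σ Matching λ M →
    partner M v ≡ nothing × (∀ u → u ≢ v → ∃[ w ] partner M u ≡ just w)

  data Reach (X : Subset n) : Fin n → Fin n → Set where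
    here  : ∀ {u} → u ∉ X → Reach X u u
    step  : ∀ {u v w} → u ∉ X → Adj G u v → Reach X v w → Reach X u w

  ConnectedMinus : Subset n → Set
  ConnectedMinus X = ∀ u v → u ∉ X → v ∉ X → Reach X u v

  KConnected : ℕ → Set
  KConnected k = n > k × (∀ X → ∣ X ∣ < k → ConnectedMinus X)

  IsVertexCut : Subset n → Set
  IsVertexCut S = ∃[ u ] ∃[ v ] (u ∉ S × v ∉ S × ¬ Reach S u v)

  TwoComponents : Subset n → Set
  TwoComponents S = ∃[ a ] ∃[ b ] (a ∉ S × b ∉ S × ¬ Reach S a b ×
    (∀ c → c ∉ S → Reach S a c ⊎ Reach S b c))

module Submission where

-- Suppose G − S had components containing a, b and c, and let M be a matching missing only a.
-- Equimatchability and factor-criticality make every maximal matching miss at most one vertex, so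
-- no matching leaves two distinct vertices stranded (uncovered, with all neighbours covered); each
-- case below builds such a matching. The tool is an alternating-path lemma: if s₀ ∈ S is exposed and
-- D is a union of components of G − S with a vertex not matched into S, an alternating path from s₀
-- into D can be switched so that s₀ becomes covered and coverage changes only inside D; otherwise the
-- S-vertices reached by alternating paths, their D-neighbours and the rest of S would form a separator
-- of fewer than k vertices. If some s ∈ S is matched outside the component of a, to u say, switching
-- strands a and u, or strands u and a further vertex d, or leaves at most two vertices outside S not
-- matched into S, so that n ≤ 2k + 2. Otherwise, rematching two vertices of S to neighbours in the
-- components of b and c strands the former partners of those neighbours.

open import Defs
open import Data.Bool using (if_then_else_)
open import Data.Empty using (⊥; ⊥-elim)
open import Data.Fin using (Fin; zero; suc)
import Data.Fin.Permutation as Perm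
open import Data.Fin.Properties using (any?; suc-injective; _≟_)
open import Data.Fin.Subset using (Subset; _∈_; _∉_; _⊆_; ∣_∣; _-_; ⁅_⁆; inside; outside)
open import Data.Fin.Subset.Properties
  using (_∈?_; drop-there; p⊂q⇒∣p∣<∣q∣; ∣p∣≤n; x∈p⇒∣p-x∣<∣p∣; p─q⊆p; x∈p∧x≢y⇒x∈p-y)
import Data.List as List
open import Data.List.Properties using (map-tabulate)
open import Data.Maybe using (Maybe; just; nothing; is-just)
open import Data.Maybe.Properties using (just-injective)
import Data.Maybe.Properties as Maybe
open import Data.Nat using (ℕ; zero; suc; _+_; _*_; _≤_; _<_; z≤n; s≤s; s≤s⁻¹)
import Data.Nat.ListAction as ListAction
open import Data.Nat.Properties
  using (+-mono-≤; +-monoʳ-≤; +-monoˡ-≤; +-monoʳ-<; ≤-refl; ≤-pred; ≤-trans; ≤-reflexive; ≤-antisym;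
         <-≤-trans; <⇒≱; m≤m+n; +-suc; +-comm; +-assoc; +-identityʳ; +-cancelˡ-≤; +-0-commutativeMonoid;
         module ≤-Reasoning)
open import Data.Product using (Σ; ∃; ∃₂; ∃-syntax; _×_; _,_; proj₁; proj₂)
open import Data.Sum using (_⊎_; inj₁; inj₂; [_,_])
open import Data.Vec using (_∷_; []; here; there; tabulate)
open import Data.Vec.Properties using (lookup∘tabulate; []=⇒lookup; lookup⇒[]=)
open import Data.Vec.Properties.WithK using ([]=-irrelevant)
open import Function using (_∘_; id; case_of_)
open import Relation.Binary.PropositionalEquality using (_≡_; _≢_; refl; trans; cong; subst; subst₂)
import Relation.Binary.PropositionalEquality as ≡
open import Relation.Nullary using (¬_; Dec; yes; no; ¬?; contradiction)
open import Relation.Unary using (Decidable)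
open import Relation.Nullary.Decidable using (_×-dec_; _⊎-dec_; does; dec-true; decidable-stable)
import Relation.Nullary.Decidable as Dec
open import Algebra.Properties.CommutativeMonoid.Sum +-0-commutativeMonoid
  using (sum; ∑-distrib-+; sum-permute; sum-cong-≗)

-- Counting over Fin n

indicator : {A : Set} → Dec A → ℕ
indicator (yes _) = 1
indicator (no _)  = 0

indicator-mono : {A B : Set} (a? : Dec A) (b? : Dec B) → (A → B) → indicator a? ≤ indicator b?
indicator-mono (yes _) (yes _) _   = s≤s z≤n
indicator-mono (yes a) (no ¬b) a⇒b = contradiction (a⇒b a) ¬b
indicator-mono (no _)  _       _   = z≤n

sum-mono : ∀ {n} {f g : Fin n → ℕ} → (∀ i → f i ≤ g i) → sum f ≤ sum g
sum-mono {zero}  _   = z≤n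
sum-mono {suc n} f≤g = +-mono-≤ (f≤g zero) (sum-mono (f≤g ∘ suc))

count : ∀ {n} {P : Fin n → Set} → Decidable P → ℕ
count P? = sum (λ x → indicator (P? x))

module _ {n : ℕ} {P Q : Fin n → Set} (P? : Decidable P) (Q? : Decidable Q) where

  count-mono : (∀ {x} → P x → Q x) → count P? ≤ count Q?
  count-mono P⇒Q = sum-mono (λ x → indicator-mono (P? x) (Q? x) P⇒Q)

  count-mono-involution : (π : Fin n → Fin n) → (∀ x → π (π x) ≡ x) → (∀ {x} → P x → Q (π x)) →
    count P? ≤ count Q?
  count-mono-involution π π-involutive P⇒Qπ =
    ≤-trans (sum-mono (λ x → indicator-mono (P? x) (Q? (π x)) P⇒Qπ))
            (≤-reflexive (≡.sym (sum-permute (λ x → indicator (Q? x)) (Perm.permutation π π π-involutive π-involutive))))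

  count-split : count P? ≡ count (λ x → P? x ×-dec Q? x) + count (λ x → P? x ×-dec ¬? (Q? x))
  count-split =
    trans (sum-cong-≗ (λ x → split (P? x) (Q? x)))
          (∑-distrib-+ (λ x → indicator (P? x ×-dec Q? x)) (λ x → indicator (P? x ×-dec ¬? (Q? x))))
    where
    split : {A B : Set} (a? : Dec A) (b? : Dec B) → indicator a? ≡ indicator (a? ×-dec b?) + indicator (a? ×-dec ¬? b?)
    split (yes _) (yes _) = refl
    split (yes _) (no _)  = refl
    split (no _)  (yes _) = refl
    split (no _)  (no _)  = refl

  count-∪ : {R : Fin n → Set} (R? : Decidable R) → (∀ {x} → R x → P x ⊎ Q x) → count R? ≤ count P? + count Q?
  count-∪ R? R⇒P⊎Q =
    ≤-trans (sum-mono (λ x → bound (P? x) (Q? x) (R? x) R⇒P⊎Q))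
            (≤-reflexive (∑-distrib-+ (λ x → indicator (P? x)) (λ x → indicator (Q? x))))
    where
    bound : {A B C : Set} (a? : Dec A) (b? : Dec B) (c? : Dec C) → (C → A ⊎ B) →
      indicator c? ≤ indicator a? + indicator b?
    bound _       _       (no _)  _ = z≤n
    bound (yes _) _       (yes _) _ = s≤s z≤n
    bound (no _)  (yes _) (yes _) _ = s≤s z≤n
    bound (no ¬a) (no ¬b) (yes c) c⇒a⊎b = contradiction (c⇒a⊎b c) [ ¬a , ¬b ]

count-cong : ∀ {n} {P Q : Fin n → Set} (P? : Decidable P) (Q? : Decidable Q) →
  (∀ {x} → P x → Q x) → (∀ {x} → Q x → P x) → count P? ≡ count Q?
count-cong P? Q? P⇒Q Q⇒P = ≤-antisym (count-mono P? Q? P⇒Q) (count-mono Q? P? Q⇒P)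

count-∁ : ∀ {n} {P : Fin n → Set} (P? : Decidable P) → count P? + count (λ x → ¬? (P? x)) ≡ n
count-∁ {zero}  P? = refl
count-∁ {suc n} P? with P? zero
... | yes _ = cong suc (count-∁ (P? ∘ suc))
... | no  _ = trans (+-suc (count (P? ∘ suc)) _) (cong suc (count-∁ (P? ∘ suc)))

count-none : ∀ {n} {P : Fin n → Set} (P? : Decidable P) → (∀ x → ¬ P x) → count P? ≡ 0
count-none {zero}  P? _  = refl
count-none {suc n} P? ¬P with P? zero
... | yes p = contradiction p (¬P zero)
... | no  _ = count-none (P? ∘ suc) (¬P ∘ suc)

count-subsingleton : ∀ {n} {P : Fin n → Set} (P? : Decidable P) → (∀ {x y} → P x → P y → x ≡ y) → count P? ≤ 1
count-subsingleton {zero}  P? _      = z≤n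
count-subsingleton {suc n} P? unique with P? zero
... | yes p = ≤-reflexive (cong suc (count-none (P? ∘ suc) (λ x q → contradiction (unique p q) λ ())))
... | no  _ = count-subsingleton (P? ∘ suc) (λ p q → suc-injective (unique p q))

count-pos : ∀ {n} {P : Fin n → Set} (P? : Decidable P) {a : Fin n} → P a → 1 ≤ count P?
count-pos {suc n} P? {zero} pa with P? zero
... | yes _ = s≤s z≤n
... | no ¬p = contradiction pa ¬p
count-pos {suc n} P? {suc a} pa with P? zero
... | yes _ = s≤s z≤n
... | no  _ = count-pos (P? ∘ suc) pa

count-pos⇒∃ : ∀ {n} {P : Fin n → Set} (P? : Decidable P) → 1 ≤ count P? → ∃ P
count-pos⇒∃ P? 1≤count with any? P?
... | yes witness = witness
... | no  none    = contradiction (≤-trans 1≤count (≤-reflexive (count-none P? (λ x p → none (x , p))))) λ ()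

count-mono-< : ∀ {n} {P Q : Fin n → Set} (P? : Decidable P) (Q? : Decidable Q) →
  (∀ {x} → P x → Q x) → ∀ {a} → Q a → ¬ P a → count P? < count Q?
count-mono-< {Q = Q} P? Q? P⇒Q {a} qa ¬pa = begin-strict
  count P?                                     ≤⟨ count-mono P? Q≢a? (λ px → P⇒Q px , λ { refl → ¬pa px }) ⟩
  count Q≢a?                                   <⟨ +-monoˡ-≤ (count Q≢a?) (count-pos Q≡a? (qa , refl)) ⟩
  count Q≡a? + count Q≢a?                      ≡⟨ count-split Q? (_≟ a) ⟨
  count Q?                                     ∎
  where
  open ≤-Reasoning
  Q≡a? : Decidable (λ x → Q x × x ≡ a)
  Q≡a? x = Q? x ×-dec x ≟ a
  Q≢a? : Decidable (λ x → Q x × x ≢ a)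
  Q≢a? x = Q? x ×-dec ¬? (x ≟ a)

count-two : ∀ {n} {P : Fin n → Set} (P? : Decidable P) {a b : Fin n} → P a → P b → a ≢ b → 2 ≤ count P?
count-two P? {a} pa pb a≢b =
  ≤-trans (+-mono-≤ (count-pos (λ x → P? x ×-dec x ≟ a) (pa , refl))
                    (count-pos (λ x → P? x ×-dec ¬? (x ≟ a)) (pb , a≢b ∘ ≡.sym)))
          (≤-reflexive (≡.sym (count-split P? (_≟ a))))

count-two⇒∃₂ : ∀ {n} {P : Fin n → Set} (P? : Decidable P) → 2 ≤ count P? → ∃₂ λ a b → P a × P b × a ≢ b
count-two⇒∃₂ P? 2≤count =
  let (a , pa)       = count-pos⇒∃ P? (≤-trans (s≤s z≤n) 2≤count)
      (b , pb , b≢a) = count-pos⇒∃ (λ x → P? x ×-dec ¬? (x ≟ a)) (another a)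
  in a , b , pa , pb , b≢a ∘ ≡.sym
  where
  another : ∀ a → 1 ≤ count (λ x → P? x ×-dec ¬? (x ≟ a))
  another a = s≤s⁻¹ (≤-trans 2≤count (≤-trans (≤-reflexive (count-split P? (_≟ a)))
    (+-monoˡ-≤ _ (count-subsingleton (λ x → P? x ×-dec x ≟ a) (λ (_ , x≡a) (_ , y≡a) → trans x≡a (≡.sym y≡a))))))

∣p∣≡count∈ : ∀ {n} (p : Subset n) → ∣ p ∣ ≡ count (_∈? p)
∣p∣≡count∈ []            = refl
∣p∣≡count∈ (inside ∷ p)  =
  cong suc (trans (∣p∣≡count∈ p) (count-cong (_∈? p) (λ x → suc x ∈? (inside ∷ p)) there drop-there))
∣p∣≡count∈ (outside ∷ p) =
  trans (∣p∣≡count∈ p) (count-cong (_∈? p) (λ x → suc x ∈? (outside ∷ p)) there drop-there)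

toSubset : ∀ {n} {P : Fin n → Set} → Decidable P → Subset n
toSubset P? = tabulate (λ x → if does (P? x) then inside else outside)

module _ {n : ℕ} {P : Fin n → Set} (P? : Decidable P) where

  ∈toSubset⁺ : ∀ {x} → P x → x ∈ toSubset P?
  ∈toSubset⁺ {x} px =
    lookup⇒[]= x _ (trans (lookup∘tabulate _ x) (cong (if_then inside else outside) (dec-true (P? x) px)))

  ∈toSubset⁻ : ∀ {x} → x ∈ toSubset P? → P x
  ∈toSubset⁻ {x} x∈ with P? x | trans (≡.sym (lookup∘tabulate _ x)) ([]=⇒lookup x∈)
  ... | yes px | _  = px
  ... | no  _  | ()

  ∣toSubset∣≡count : ∣ toSubset P? ∣ ≡ count P?
  ∣toSubset∣≡count = trans (∣p∣≡count∈ (toSubset P?)) (count-cong (_∈? toSubset P?) P? ∈toSubset⁻ ∈toSubset⁺)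

module _ {n : ℕ} (f : Subset n → Subset n) (f-inflationary : ∀ T → T ⊆ f T) where

  closure-induction : {A : Set} (Inv : Subset n → Set) → (∀ {T} → Inv T → A ⊎ Inv (f T)) →
    ∀ {T} → Inv T → A ⊎ ∃[ C ] (f C ⊆ C × Inv C)
  closure-induction {A} Inv advance {T} = go n (m≤m+n n ∣ T ∣)
    where
    go : ∀ room {T} → n ≤ room + ∣ T ∣ → Inv T → A ⊎ ∃[ C ] (f C ⊆ C × Inv C)
    go room {T} bound inv with any? (λ x → x ∈? f T ×-dec ¬? (x ∈? T)) | advance inv
    ... | no stuck | _ = inj₂ (T , (λ {x} x∈fT → decidable-stable (x ∈? T) λ x∉T → stuck (x , x∈fT , x∉T)) , inv)
    ... | yes _   | inj₁ a    = inj₁ a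
    ... | yes new | inj₂ inv′ = recurse room bound
      where
      growth : ∣ T ∣ < ∣ f T ∣
      growth = p⊂q⇒∣p∣<∣q∣ (f-inflationary T , new)
      recurse : ∀ room → n ≤ room + ∣ T ∣ → A ⊎ ∃[ C ] (f C ⊆ C × Inv C)
      recurse zero    bound = contradiction bound (<⇒≱ (<-≤-trans growth (∣p∣≤n (f T))))
      recurse (suc r) bound =
        go r (≤-trans bound (≤-trans (≤-reflexive (≡.sym (+-suc r ∣ T ∣))) (+-monoʳ-≤ r growth))) inv′

-- Walks in G − X

module _ {n : ℕ} (G : Graph n) {X : Subset n} where

  reach-source∉ : ∀ {u v} → Reach G X u v → u ∉ X
  reach-source∉ (here u∉X)     = u∉X
  reach-source∉ (step u∉X _ _) = u∉X

  reach-target∉ : ∀ {u v} → Reach G X u v → v ∉ X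
  reach-target∉ (here v∉X)    = v∉X
  reach-target∉ (step _ _ uv) = reach-target∉ uv

  reach-trans : ∀ {u v w} → Reach G X u v → Reach G X v w → Reach G X u w
  reach-trans (here _)         vw = vw
  reach-trans (step u∉X e uv) vw = step u∉X e (reach-trans uv vw)

  reach-edge : ∀ {u v} → u ∉ X → v ∉ X → Adj G u v → Reach G X u v
  reach-edge u∉X v∉X e = step u∉X e (here v∉X)

  reach-sym : ∀ {u v} → Reach G X u v → Reach G X v u
  reach-sym (here u∉X)       = here u∉X
  reach-sym (step u∉X e wv) = reach-trans (reach-sym wv) (reach-edge (reach-source∉ wv) u∉X (sym G e))

  Grow : Subset n → Fin n → Set
  Grow T y = y ∈ T ⊎ (y ∉ X × ∃[ z ] (z ∈ T × Adj G z y))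

  grow? : ∀ T y → Dec (Grow T y)
  grow? T y = y ∈? T ⊎-dec (¬? (y ∈? X) ×-dec any? (λ z → z ∈? T ×-dec adj? G z y))

  grow : Subset n → Subset n
  grow T = toSubset (grow? T)

  grow-inflationary : ∀ T → T ⊆ grow T
  grow-inflationary T x∈T = ∈toSubset⁺ (grow? T) (inj₁ x∈T)

  grow-closed⇒reach-closed : ∀ {C} → grow C ⊆ C → ∀ {w y} → w ∈ C → Reach G X w y → y ∈ C
  grow-closed⇒reach-closed closed w∈C (here _)             = w∈C
  grow-closed⇒reach-closed closed w∈C (step _ e reach) =
    grow-closed⇒reach-closed closed (closed (∈toSubset⁺ (grow? _) (inj₂ (reach-source∉ reach , _ , w∈C , e)))) reach

  reach? : ∀ u v → Dec (Reach G X u v)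
  reach? u v with u ∈? X
  ... | yes u∈X = no (λ uv → reach-source∉ uv u∈X)
  ... | no  u∉X = decide (closure-induction grow grow-inflationary Reachable (inj₂ ∘ extend) start)
    where
    Reachable : Subset n → Set
    Reachable T = u ∈ T × (∀ {y} → y ∈ T → Reach G X u y)

    start : Reachable (toSubset (_≟ u))
    start = ∈toSubset⁺ (_≟ u) refl , λ y∈ → case ∈toSubset⁻ (_≟ u) y∈ of λ { refl → here u∉X }

    extend : ∀ {T} → Reachable T → Reachable (grow T)
    extend (u∈T , reach) = grow-inflationary _ u∈T , λ y∈ → case ∈toSubset⁻ (grow? _) y∈ of λ where
      (inj₁ y∈T)                 → reach y∈T
      (inj₂ (y∉X , z , z∈T , e)) → reach-trans (reach z∈T) (reach-edge (reach-target∉ (reach z∈T)) y∉X e)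

    decide : ⊥ ⊎ ∃[ C ] (grow C ⊆ C × Reachable C) → Dec (Reach G X u v)
    decide (inj₂ (C , closed , u∈C , reach)) with v ∈? C
    ... | yes v∈C = yes (reach v∈C)
    ... | no  v∉C = no (λ uv → v∉C (grow-closed⇒reach-closed closed u∈C uv))

-- Matchings

module _ {n : ℕ} {G : Graph n} where

  Covered : Matching G → Fin n → Set
  Covered M u = ∃[ w ] partner M u ≡ just w

  covered? : ∀ (M : Matching G) u → Dec (Covered M u)
  covered? M u with partner M u
  ... | just w  = yes (w , refl)
  ... | nothing = no λ ()

  nothing≢just : ∀ {w : Fin n} → nothing ≢ just w
  nothing≢just ()

  uncovered⇒¬Covered : ∀ (M : Matching G) {u} → partner M u ≡ nothing → ¬ Covered M u
  uncovered⇒¬Covered M u-free (w , u-w) = nothing≢just (trans (≡.sym u-free) u-w)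

  ¬Covered⇒uncovered : ∀ (M : Matching G) {u} → ¬ Covered M u → partner M u ≡ nothing
  ¬Covered⇒uncovered M {u} ¬cov with partner M u
  ... | just w  = contradiction (w , refl) ¬cov
  ... | nothing = refl

  partner-adj : ∀ (M : Matching G) {u v} → partner M u ≡ just v → Adj G u v
  partner-adj M {u} {v} u-v = proj₁ (isMatching M u v u-v)

  partner-sym : ∀ (M : Matching G) {u v} → partner M u ≡ just v → partner M v ≡ just u
  partner-sym M {u} {v} u-v = proj₂ (isMatching M u v u-v)

  partner-irrefl : ∀ (M : Matching G) {u v} → partner M u ≡ just v → u ≢ v
  partner-irrefl M u-v refl = irrefl G (partner-adj M u-v)

  uncovered? : (M : Matching G) → ∀ u → Dec (¬ Covered M u)
  uncovered? M u = ¬? (covered? M u)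

  ⊆ᴹ-refl : {M : Matching G} → _⊆ᴹ_ G M M
  ⊆ᴹ-refl _ _ u-v = u-v

  ⊆ᴹ-trans : {M M′ M″ : Matching G} → _⊆ᴹ_ G M M′ → _⊆ᴹ_ G M′ M″ → _⊆ᴹ_ G M M″
  ⊆ᴹ-trans M⊆M′ M′⊆M″ u v u-v = M′⊆M″ u v (M⊆M′ u v u-v)

  ⊆ᴹ-covered : {M M′ : Matching G} → _⊆ᴹ_ G M M′ → ∀ {u} → Covered M u → Covered M′ u
  ⊆ᴹ-covered M⊆M′ (w , u-w) = w , M⊆M′ _ w u-w

  ⊆ᴹ-uncovered : {M M′ : Matching G} → _⊆ᴹ_ G M M′ → ∀ {u} → partner M′ u ≡ nothing → partner M u ≡ nothing
  ⊆ᴹ-uncovered {M} M⊆M′ {u} u-free′ with partner M u in u-m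
  ... | nothing = refl
  ... | just w  = contradiction (trans (≡.sym u-free′) (M⊆M′ u w u-m)) λ ()

  covered≡count : ∀ (M : Matching G) → covered G M ≡ count (covered? M)
  covered≡count M =
    trans (cong ListAction.sum (map-tabulate id covers)) (trans (sum-tabulate covers) (sum-cong-≗ indicator-covered))
    where
    covers : Fin n → ℕ
    covers u = if is-just (partner M u) then 1 else 0
    sum-tabulate : ∀ {m} (f : Fin m → ℕ) → ListAction.sum (List.tabulate f) ≡ sum f
    sum-tabulate {zero}  f = refl
    sum-tabulate {suc m} f = cong (f zero +_) (sum-tabulate (f ∘ suc))
    indicator-covered : ∀ u → covers u ≡ indicator (covered? M u)
    indicator-covered u with partner M u
    ... | just _  = refl
    ... | nothing = refl

  mate : Matching G → Fin n → Fin n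
  mate M u with partner M u
  ... | just v  = v
  ... | nothing = u

  mate-just : ∀ (M : Matching G) {u v} → partner M u ≡ just v → mate M u ≡ v
  mate-just M {u} u-v with partner M u
  mate-just M refl | just v = refl

  mate-nothing : ∀ (M : Matching G) {u} → partner M u ≡ nothing → mate M u ≡ u
  mate-nothing M {u} u-free with partner M u
  mate-nothing M refl | nothing = refl

  mate-involutive : ∀ (M : Matching G) u → mate M (mate M u) ≡ u
  mate-involutive M u with partner M u in u-m
  ... | just v  = mate-just M (partner-sym M u-m)
  ... | nothing = mate-nothing M u-m

  private
    unless : {A : Set} → Dec A → Maybe (Fin n) → Maybe (Fin n)
    unless (yes _) _ = nothing
    unless (no _)  m = m

    unless-yes : {A : Set} (a? : Dec A) {m : Maybe (Fin n)} → A → unless a? m ≡ nothing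
    unless-yes (yes _) _ = refl
    unless-yes (no ¬a) a = contradiction a ¬a

    unless-no : {A : Set} (a? : Dec A) {m : Maybe (Fin n)} → ¬ A → unless a? m ≡ m
    unless-no (yes a) ¬a = contradiction a ¬a
    unless-no (no _)  _  = refl

    unless-just : {A : Set} (a? : Dec A) {m : Maybe (Fin n)} {y : Fin n} → unless a? m ≡ just y → ¬ A × m ≡ just y
    unless-just (no ¬a) m-y = ¬a , m-y

  module _ (M : Matching G) {P : Fin n → Set} (P? : Decidable P) where

    MateIn : Fin n → Set
    MateIn w = ∃[ z ] (partner M w ≡ just z × P z)

    -- Matching surgery is abstract: the constructed matchings are used only through their lemmas.
    abstract
      private
        mateIn? : ∀ w → Dec (MateIn w)
        mateIn? w with partner M w
        ... | nothing = no λ ()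
        ... | just z  = Dec.map′ (λ pz → z , refl , pz) (λ { (_ , refl , pz) → pz }) (P? z)

        touches? : ∀ w → Dec (P w ⊎ MateIn w)
        touches? w = P? w ⊎-dec mateIn? w

        released : Fin n → Maybe (Fin n)
        released w = unless (touches? w) (partner M w)

      release : Matching G
      release = record { partner = released ; isMatching = matching }
        where
        matching : IsMatching G released
        matching u w u-w′ with unless-just (touches? u) u-w′
        ... | ¬touches-u , u-w with touches? w
        ... | no _                     = partner-adj M u-w , partner-sym M u-w
        ... | yes (inj₁ Pw)            = contradiction (inj₂ (w , u-w , Pw)) ¬touches-u
        ... | yes (inj₂ (z , w-z , Pz)) with just-injective (trans (≡.sym (partner-sym M u-w)) w-z)
        ...   | refl = contradiction (inj₁ Pz) ¬touches-u

      release-touched : ∀ {v} → P v → partner release v ≡ nothing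
      release-touched Pv = unless-yes (touches? _) (inj₁ Pv)

      release-mate : ∀ {v w} → P v → partner M v ≡ just w → partner release w ≡ nothing
      release-mate Pv v-w = unless-yes (touches? _) (inj₂ (_ , partner-sym M v-w , Pv))

      release-other : ∀ {w} → ¬ P w → ¬ MateIn w → partner release w ≡ partner M w
      release-other ¬Pw ¬mate = unless-no (touches? _) λ where
        (inj₁ Pw)   → ¬Pw Pw
        (inj₂ mate) → ¬mate mate

      release-⊆ : _⊆ᴹ_ G release M
      release-⊆ w y w-y = proj₂ (unless-just (touches? w) w-y)

      release-uncovered : ∀ {w} → partner release w ≡ nothing → partner M w ≡ nothing ⊎ P w ⊎ MateIn w
      release-uncovered {w} w-free with touches? w
      ... | yes (inj₁ Pw)   = inj₂ (inj₁ Pw)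
      ... | yes (inj₂ mate) = inj₂ (inj₂ mate)
      ... | no _            = inj₁ w-free

  unmatch : Matching G → Fin n → Matching G
  unmatch M v = release M (_≟ v)

  unmatch-self : ∀ (M : Matching G) v → partner (unmatch M v) v ≡ nothing
  unmatch-self M v = release-touched M (_≟ v) refl

  unmatch-mate : ∀ (M : Matching G) {v w} → partner M v ≡ just w → partner (unmatch M v) w ≡ nothing
  unmatch-mate M = release-mate M (_≟ _) refl

  unmatch-≢ : ∀ (M : Matching G) {v u w} → partner M v ≡ just u → w ≢ v → w ≢ u →
    partner (unmatch M v) w ≡ partner M w
  unmatch-≢ M v-u w≢v w≢u = release-other M (_≟ _) w≢v λ where
    (_ , w-v , refl) → w≢u (just-injective (trans (≡.sym (partner-sym M w-v)) v-u))

  module _ (M : Matching G) {x y : Fin n}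
    (x-free : partner M x ≡ nothing) (y-free : partner M y ≡ nothing) (xy : Adj G x y) where

    abstract
      private
        paired : Fin n → Maybe (Fin n)
        paired w with w ≟ x | w ≟ y
        ... | yes _ | _     = just y
        ... | no _  | yes _ = just x
        ... | no _  | no _  = partner M w

        paired-left : paired x ≡ just y
        paired-left with x ≟ x
        ... | yes _   = refl
        ... | no x≢x = contradiction refl x≢x

        paired-right : paired y ≡ just x
        paired-right with y ≟ x | y ≟ y
        ... | yes refl | _      = contradiction xy (irrefl G)
        ... | no _     | yes _  = refl
        ... | no _     | no y≢y = contradiction refl y≢y

        paired-other : ∀ {w} → w ≢ x → w ≢ y → paired w ≡ partner M w
        paired-other {w} w≢x w≢y with w ≟ x | w ≟ y
        ... | yes w≡x | _       = contradiction w≡x w≢x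
        ... | no _    | yes w≡y = contradiction w≡y w≢y
        ... | no _    | no _    = refl

      match : Matching G
      match = record { partner = paired ; isMatching = matching }
        where
        matching : IsMatching G paired
        matching u w u-w = by-cases (u ≟ x) (u ≟ y)
          where
          by-cases : Dec (u ≡ x) → Dec (u ≡ y) → Adj G u w × paired w ≡ just u
          by-cases (yes refl) _ with just-injective (trans (≡.sym paired-left) u-w)
          ... | refl = xy , paired-right
          by-cases (no _) (yes refl) with just-injective (trans (≡.sym paired-right) u-w)
          ... | refl = sym G xy , paired-left
          by-cases (no u≢x) (no u≢y) = partner-adj M u-w′ , trans (paired-other w≢x w≢y) (partner-sym M u-w′)
            where
            u-w′ : partner M u ≡ just w
            u-w′ = trans (≡.sym (paired-other u≢x u≢y)) u-w
            w≢x : w ≢ x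
            w≢x refl = nothing≢just (trans (≡.sym x-free) (partner-sym M u-w′))
            w≢y : w ≢ y
            w≢y refl = nothing≢just (trans (≡.sym y-free) (partner-sym M u-w′))

      match-left : partner match x ≡ just y
      match-left = paired-left

      match-right : partner match y ≡ just x
      match-right = paired-right

      match-other : ∀ {w} → w ≢ x → w ≢ y → partner match w ≡ partner M w
      match-other = paired-other

      match-⊇ : _⊆ᴹ_ G M match
      match-⊇ w z w-z = trans (match-other w≢x w≢y) w-z
        where
        w≢x : w ≢ x
        w≢x refl = nothing≢just (trans (≡.sym x-free) w-z)
        w≢y : w ≢ y
        w≢y refl = nothing≢just (trans (≡.sym y-free) w-z)

  module _ (M : Matching G) {r x y : Fin n}
    (r-free : partner M r ≡ nothing) (x-y : partner M x ≡ just y) (rx : Adj G r x) where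

    private
      r≢x : r ≢ x
      r≢x refl = irrefl G rx

      r≢y : r ≢ y
      r≢y refl = nothing≢just (trans (≡.sym r-free) (partner-sym M x-y))

      M₁ : Matching G
      M₁ = unmatch M x

      M₁-r : partner M₁ r ≡ nothing
      M₁-r = trans (unmatch-≢ M x-y r≢x r≢y) r-free

    redirect : Matching G
    redirect = match M₁ M₁-r (unmatch-self M x) rx

    redirect-source : partner redirect r ≡ just x
    redirect-source = match-left M₁ M₁-r (unmatch-self M x) rx

    redirect-pivot : partner redirect x ≡ just r
    redirect-pivot = match-right M₁ M₁-r (unmatch-self M x) rx

    redirect-old : partner redirect y ≡ nothing
    redirect-old = trans (match-other M₁ M₁-r (unmatch-self M x) rx (r≢y ∘ ≡.sym) (partner-irrefl M x-y ∘ ≡.sym))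
                         (unmatch-mate M x-y)

    redirect-other : ∀ {w} → w ≢ r → w ≢ x → w ≢ y → partner redirect w ≡ partner M w
    redirect-other w≢r w≢x w≢y =
      trans (match-other M₁ M₁-r (unmatch-self M x) rx w≢r w≢x) (unmatch-≢ M x-y w≢x w≢y)

-- Maximal matchings

module _ {n : ℕ} {G : Graph n} where

  maximal-if-no-free-edge : (M : Matching G) →
    (∀ {x y} → partner M x ≡ nothing → partner M y ≡ nothing → ¬ Adj G x y) → IsMaximal G M
  maximal-if-no-free-edge M no-free-edge M′ M⊆M′ u v u-v′ with partner M u in u-m | partner M v in v-m
  ... | just w  | _       = trans (≡.sym (M⊆M′ u w u-m)) u-v′
  ... | nothing | nothing = contradiction (partner-adj M′ u-v′) (no-free-edge u-m v-m)
  ... | nothing | just w with just-injective (trans (≡.sym (M⊆M′ v w v-m)) (partner-sym M′ u-v′))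
  ...   | refl = contradiction (trans (≡.sym u-m) (partner-sym M v-m)) λ ()

  match-free-edge : (M : Matching G) {x y : Fin n} → ¬ Covered M x → ¬ Covered M y → Adj G x y →
    ∃[ M₁ ] (_⊆ᴹ_ G M M₁ × count (uncovered? M₁) < count (uncovered? M))
  match-free-edge M {x} {y} x-free y-free xy = M₁ , M⊆M₁ ,
    count-mono-< (uncovered? M₁) (uncovered? M) (λ ¬cov cov → ¬cov (⊆ᴹ-covered {M = M} {M₁} M⊆M₁ cov)) x-free
      (λ ¬cov → ¬cov (y , match-left M x-free′ y-free′ xy))
    where
    x-free′ : partner M x ≡ nothing
    x-free′ = ¬Covered⇒uncovered M x-free
    y-free′ : partner M y ≡ nothing
    y-free′ = ¬Covered⇒uncovered M y-free
    M₁ : Matching G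
    M₁ = match M x-free′ y-free′ xy
    M⊆M₁ : _⊆ᴹ_ G M M₁
    M⊆M₁ = match-⊇ M x-free′ y-free′ xy

  extend-to-maximal : (M : Matching G) → ∃[ M′ ] (_⊆ᴹ_ G M M′ × IsMaximal G M′)
  extend-to-maximal M = go (count (uncovered? M)) M ≤-refl
    where
    go : ∀ fuel (M : Matching G) → count (uncovered? M) ≤ fuel → ∃[ M′ ] (_⊆ᴹ_ G M M′ × IsMaximal G M′)
    go fuel M bound with any? (λ x → any? (λ y → (uncovered? M x ×-dec uncovered? M y) ×-dec adj? G x y))
    ... | no none = M , ⊆ᴹ-refl {M = M} , maximal-if-no-free-edge M λ {x} {y} x-free y-free xy →
                      none (x , y , (uncovered⇒¬Covered M x-free , uncovered⇒¬Covered M y-free) , xy)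
    ... | yes (x , y , (x-free , y-free) , xy) with fuel | match-free-edge M x-free y-free xy
    ...   | zero      | _ = contradiction (≤-trans (count-pos (uncovered? M) x-free) bound) λ ()
    ...   | suc fuel′ | M₁ , M⊆M₁ , fewer with go fuel′ M₁ (≤-pred (≤-trans fewer bound))
    ...     | M′ , M₁⊆M′ , maximal = M′ , ⊆ᴹ-trans {M = M} {M₁} {M′} M⊆M₁ M₁⊆M′ , maximal

  Stranded : Matching G → Fin n → Set
  Stranded M u = partner M u ≡ nothing × (∀ {y} → Adj G u y → Covered M y)

  stranded-stays-uncovered : {M M′ : Matching G} → _⊆ᴹ_ G M M′ → ∀ {u} → Stranded M u → partner M′ u ≡ nothing
  stranded-stays-uncovered {M = M} {M′} M⊆M′ {u} (u-free , neighbours-covered) with partner M′ u in u-m′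
  ... | nothing = refl
  ... | just y with neighbours-covered (partner-adj M′ u-m′)
  ...   | z , y-z with just-injective (trans (≡.sym (M⊆M′ y z y-z)) (partner-sym M′ u-m′))
  ...     | refl = contradiction (trans (≡.sym u-free) (partner-sym M y-z)) λ ()

module _ {n : ℕ} {G : Graph n} (equimatchable : Equimatchable G) (factor-critical : FactorCritical G) where

  maximal-misses-at-most-one : (M : Matching G) → IsMaximal G M →
    ∀ {u v} → partner M u ≡ nothing → partner M v ≡ nothing → u ≡ v
  maximal-misses-at-most-one M maximal {u} {v} u-free v-free with u ≟ v
  ... | yes u≡v = u≡v
  ... | no  u≢v = contradiction (+-cancelˡ-≤ (count (covered? M)) 2 1 bound) λ { (s≤s ()) }
    where
    M₀ : Matching G
    M₀ = proj₁ (factor-critical u)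
    misses-only-u : ∀ {x} → ¬ Covered M₀ x → x ≡ u
    misses-only-u {x} ¬cov with x ≟ u
    ... | yes x≡u = x≡u
    ... | no  x≢u = contradiction (proj₂ (proj₂ (factor-critical u)) x x≢u) ¬cov
    two-missed : 2 ≤ count (uncovered? M)
    two-missed = count-two (uncovered? M) (uncovered⇒¬Covered M u-free) (uncovered⇒¬Covered M v-free) u≢v
    M₀-no-larger : count (covered? M₀) ≤ count (covered? M)
    M₀-no-larger = subst₂ _≤_ (covered≡count M₀) (covered≡count M) (equimatchable M maximal M₀)
    M₀-misses-one : count (uncovered? M₀) ≤ 1
    M₀-misses-one = count-subsingleton (uncovered? M₀) λ p q → trans (misses-only-u p) (≡.sym (misses-only-u q))
    bound : count (covered? M) + 2 ≤ count (covered? M) + 1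
    bound = begin
      count (covered? M) + 2                       ≤⟨ +-monoʳ-≤ _ two-missed ⟩
      count (covered? M) + count (uncovered? M)    ≡⟨ count-∁ (covered? M) ⟩
      n                                            ≡⟨ count-∁ (covered? M₀) ⟨
      count (covered? M₀) + count (uncovered? M₀)  ≤⟨ +-mono-≤ M₀-no-larger M₀-misses-one ⟩
      count (covered? M) + 1                       ∎
      where open ≤-Reasoning

  no-two-stranded : (M : Matching G) → ∀ {u v} → u ≢ v → Stranded M u → Stranded M v → ⊥
  no-two-stranded M u≢v u-stranded v-stranded with extend-to-maximal M
  ... | M′ , M⊆M′ , maximal = u≢v (maximal-misses-at-most-one M′ maximal
          (stranded-stays-uncovered {M = M} {M′} M⊆M′ u-stranded)
          (stranded-stays-uncovered {M = M} {M′} M⊆M′ v-stranded))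

-- Alternating paths at a vertex cut

module VertexCut {n : ℕ} (G : Graph n) {k : ℕ} (S : Subset n) (∣S∣≡k : ∣ S ∣ ≡ k)
  (connected : ∀ X → ∣ X ∣ < k → ConnectedMinus G X) where

  _~_ : Fin n → Fin n → Set
  _~_ = Reach G S

  ∈≢∉ : ∀ {x y} → x ∈ S → y ∉ S → x ≢ y
  ∈≢∉ x∈S y∉S refl = y∉S x∈S

  ∉≢∈ : ∀ {x y} → x ∉ S → y ∈ S → x ≢ y
  ∉≢∈ x∉S y∈S refl = x∉S y∈S

  ≁⇒≢ : ∀ {x y} → x ∉ S → ¬ x ~ y → x ≢ y
  ≁⇒≢ x∉S x≁y refl = x≁y (here x∉S)

  ~-edge : ∀ {x y} → x ~ y → y ∉ S → ∀ {z} → Adj G y z → z ∉ S → x ~ z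
  ~-edge x~y y∉S yz z∉S = reach-trans G x~y (reach-edge G y∉S z∉S yz)

  IntoS : Matching G → Fin n → Set
  IntoS N x = ∃[ y ] (partner N x ≡ just y × y ∈ S)

  intoS? : ∀ N x → Dec (IntoS N x)
  intoS? N x with partner N x
  ... | nothing = no λ ()
  ... | just y with y ∈? S
  ...   | yes y∈S = yes (y , refl , y∈S)
  ...   | no  y∉S = no λ { (_ , refl , y∈S) → y∉S y∈S }

  abstract
    neighbour-in-component : ∀ {s x z} → s ∈ S → x ∉ S → z ∉ S → ¬ x ~ z → ∃[ y ] (x ~ y × Adj G s y)
    neighbour-in-component {s} {x} {z} s∈S x∉S z∉S x≁z =
      walk (here x∉S) (connected (S - s) smaller x z (∉S-s x∉S) (∉S-s z∉S))
      where
      smaller : ∣ S - s ∣ < k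
      smaller = subst (∣ S - s ∣ <_) ∣S∣≡k (x∈p⇒∣p-x∣<∣p∣ s∈S)
      ∉S-s : ∀ {w} → w ∉ S → w ∉ S - s
      ∉S-s w∉S w∈ = w∉S (p─q⊆p S ⁅ s ⁆ w∈)
      walk : ∀ {w} → x ~ w → Reach G (S - s) w z → ∃[ y ] (x ~ y × Adj G s y)
      walk x~w (here _) = contradiction x~w x≁z
      walk {w} x~w (step {v = w′} _ ww′ rest) with w′ ≟ s
      ... | yes refl = w , x~w , sym G ww′
      ... | no  w′≢s = walk (reach-trans G x~w (reach-edge G (reach-target∉ G x~w) w′∉S ww′)) rest
        where
        w′∉S : w′ ∉ S
        w′∉S w′∈S = reach-source∉ G rest (x∈p∧x≢y⇒x∈p-y w′∈S w′≢s)

  module AlternatingPaths (D : Fin n → Set) (D? : Decidable D) (D∉S : ∀ {x} → D x → x ∉ S)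
    (D-closed : ∀ {x y} → D x → y ∉ S → Adj G x y → D y)
    (M : Matching G) {s₀ : Fin n} (s₀∈S : s₀ ∈ S) (s₀-free : partner M s₀ ≡ nothing) where

    record Shift : Set where
      field
        matching        : Matching G
        agrees-off-D    : ∀ v → v ∉ S → ¬ D v → partner matching v ≡ partner M v
        keeps-covered   : ∀ v → ¬ D v → v ≡ s₀ ⊎ Covered M v → Covered matching v
        keeps-uncovered : ∀ v → ¬ D v → v ≢ s₀ → partner M v ≡ nothing → partner matching v ≡ nothing

    -- W arises from M by switching an M-alternating path from s₀ to r whose inner vertices alternate
    -- between D and S, so only vertices of S ∪ D change partners.
    record Switched (r : Fin n) : Set where
      field
        W               : Matching G
        agrees-off-D    : ∀ v → v ∉ S → ¬ D v → partner W v ≡ partner M v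
        freed           : ∀ v → partner W v ≡ nothing → (partner M v ≡ nothing × v ≢ s₀) ⊎ v ≡ r
        keeps-uncovered : ∀ v → ¬ D v → v ≢ s₀ → partner M v ≡ nothing → partner W v ≡ nothing

    ¬D-S : ∀ {v} → v ∈ S → ¬ D v
    ¬D-S v∈S Dv = D∉S Dv v∈S

    switched⇒shift : ∀ {r} → D r → Switched r → Shift
    switched⇒shift {r} Dr sw = record
      { matching        = W
      ; agrees-off-D    = agrees-off-D
      ; keeps-covered   = λ v → still-covered
      ; keeps-uncovered = keeps-uncovered
      }
      where
      open Switched sw
      still-covered : ∀ {v} → ¬ D v → v ≡ s₀ ⊎ Covered M v → Covered W v
      still-covered {v} ¬Dv was with partner W v in v-w | was
      ... | just w  | _ = w , refl
      ... | nothing | inj₂ cov with freed v v-w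
      ...   | inj₁ (v-free , _) = contradiction cov (uncovered⇒¬Covered M v-free)
      ...   | inj₂ refl         = contradiction Dr ¬Dv
      still-covered {v} ¬Dv was | nothing | inj₁ refl with freed v v-w
      ...   | inj₁ (_ , v≢s₀) = contradiction refl v≢s₀
      ...   | inj₂ refl       = contradiction Dr ¬Dv

    -- A path ending at an exposed r ∈ S; the D-vertices on it were matched by M into T.
    record Tip (T : Subset n) (r : Fin n) : Set where
      field
        switched : Switched r
      open Switched switched public
      field
        hole   : partner W r ≡ nothing
        moved  : ∀ v → D v → partner W v ≢ partner M v → ∃[ y ] (partner M v ≡ just y × y ∈ T)
        origin : r ≡ s₀ ⊎ Covered M r

    tip₀ : ∀ {T} → Tip T s₀
    tip₀ = record
      { switched = record
        { W               = M
        ; agrees-off-D    = λ _ _ _ → refl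
        ; freed           = λ v v-free → case v ≟ s₀ of λ where
                              (yes v≡s₀) → inj₂ v≡s₀
                              (no v≢s₀)  → inj₁ (v-free , v≢s₀)
        ; keeps-uncovered = λ _ _ _ v-free → v-free
        }
      ; hole   = s₀-free
      ; moved  = λ _ _ differs → contradiction refl differs
      ; origin = inj₁ refl
      }

    tip-mono : ∀ {T T′ r} → T ⊆ T′ → Tip T r → Tip T′ r
    tip-mono T⊆T′ tip = record
      { switched = switched
      ; hole     = hole
      ; moved    = λ v Dv differs → let (y , v-y , y∈T) = moved v Dv differs in y , v-y , T⊆T′ y∈T
      ; origin   = origin
      }
      where open Tip tip

    module FromTip {T : Subset n} {r : Fin n} (tip : Tip T r) (r∈S : r ∈ S)
      {x : Fin n} (Dx : D x) (rx : Adj G r x) where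

      open Tip tip

      private
        D≢r : ∀ {v} → D v → v ≢ r
        D≢r Dv refl = D∉S Dv r∈S

        ¬D≢x : ∀ {v} → ¬ D v → v ≢ x
        ¬D≢x ¬Dv refl = ¬Dv Dx

        originally-free≢r : ∀ {v} → v ≢ s₀ → partner M v ≡ nothing → v ≢ r
        originally-free≢r v≢s₀ v-free refl with origin
        ... | inj₁ r≡s₀ = v≢s₀ r≡s₀
        ... | inj₂ cov  = uncovered⇒¬Covered M v-free cov

      through-free : partner W x ≡ nothing → Switched x
      through-free x-free = record
        { W               = W′
        ; agrees-off-D    = λ v v∉S ¬Dv → trans (match-other W hole x-free rx (λ { refl → v∉S r∈S }) (¬D≢x ¬Dv))
                                                (agrees-off-D v v∉S ¬Dv)
        ; freed           = freed′
        ; keeps-uncovered = λ v ¬Dv v≢s₀ v-free →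
            trans (match-other W hole x-free rx (originally-free≢r v≢s₀ v-free) (¬D≢x ¬Dv))
                  (keeps-uncovered v ¬Dv v≢s₀ v-free)
        }
        where
        W′ : Matching G
        W′ = match W hole x-free rx
        freed′ : ∀ v → partner W′ v ≡ nothing → (partner M v ≡ nothing × v ≢ s₀) ⊎ v ≡ x
        freed′ v v-free = by-cases (v ≟ r) (v ≟ x)
          where
          by-cases : Dec (v ≡ r) → Dec (v ≡ x) → (partner M v ≡ nothing × v ≢ s₀) ⊎ v ≡ x
          by-cases (yes refl) _         = contradiction (trans (≡.sym v-free) (match-left W hole x-free rx)) λ ()
          by-cases (no _)     (yes v≡x) = inj₂ v≡x
          by-cases (no v≢r)   (no v≢x) with freed v (trans (≡.sym (match-other W hole x-free rx v≢r v≢x)) v-free)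
          ... | inj₁ free = inj₁ free
          ... | inj₂ v≡r  = contradiction v≡r v≢r

      module _ {y : Fin n} (x-y : partner W x ≡ just y) where

        private
          W′ : Matching G
          W′ = redirect W hole x-y rx

          ∉S≢y : ∀ {v} → v ∉ S → ¬ D v → v ≢ y
          ∉S≢y v∉S ¬Dv refl = ¬Dv (D-closed Dx v∉S (partner-adj W x-y))

        through-matched : Switched y
        through-matched = record
          { W               = W′
          ; agrees-off-D    = λ v v∉S ¬Dv →
              trans (redirect-other W hole x-y rx (λ { refl → v∉S r∈S }) (¬D≢x ¬Dv) (∉S≢y v∉S ¬Dv))
                    (agrees-off-D v v∉S ¬Dv)
          ; freed           = freed′
          ; keeps-uncovered = keeps-uncovered′
          }
          where
          freed′ : ∀ v → partner W′ v ≡ nothing → (partner M v ≡ nothing × v ≢ s₀) ⊎ v ≡ y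
          freed′ v v-free = by-cases (v ≟ r) (v ≟ x) (v ≟ y)
            where
            by-cases : Dec (v ≡ r) → Dec (v ≡ x) → Dec (v ≡ y) → (partner M v ≡ nothing × v ≢ s₀) ⊎ v ≡ y
            by-cases (yes refl) _         _         = contradiction (trans (≡.sym v-free) (redirect-source W hole x-y rx)) λ ()
            by-cases (no _)     (yes refl) _        = contradiction (trans (≡.sym v-free) (redirect-pivot W hole x-y rx)) λ ()
            by-cases (no _)     (no _)    (yes v≡y) = inj₂ v≡y
            by-cases (no v≢r)   (no v≢x)  (no v≢y)
              with freed v (trans (≡.sym (redirect-other W hole x-y rx v≢r v≢x v≢y)) v-free)
            ... | inj₁ free = inj₁ free
            ... | inj₂ v≡r  = contradiction v≡r v≢r
          keeps-uncovered′ : ∀ v → ¬ D v → v ≢ s₀ → partner M v ≡ nothing → partner W′ v ≡ nothing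
          keeps-uncovered′ v ¬Dv v≢s₀ v-free with v ≟ y
          ... | yes refl = redirect-old W hole x-y rx
          ... | no v≢y   = trans (redirect-other W hole x-y rx (originally-free≢r v≢s₀ v-free) (¬D≢x ¬Dv) v≢y)
                                 (keeps-uncovered v ¬Dv v≢s₀ v-free)

        next-tip : ∀ {T′} → y ∈ S → T ⊆ T′ → (partner W x ≡ partner M x → y ∈ T′) → Tip T′ y
        next-tip {T′} y∈S T⊆T′ y∈T′ = record
          { switched = through-matched
          ; hole     = redirect-old W hole x-y rx
          ; moved    = moved′
          ; origin   = origin′
          }
          where
          moved′ : ∀ v → D v → partner W′ v ≢ partner M v → ∃[ z ] (partner M v ≡ just z × z ∈ T′)
          moved′ v Dv differs = by-cases (v ≟ x)
            where
            by-cases : Dec (v ≡ x) → ∃[ z ] (partner M v ≡ just z × z ∈ T′)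
            by-cases (no v≢x) =
              let (z , v-z , z∈T) = moved v Dv (differs ∘ trans (redirect-other W hole x-y rx (D≢r Dv) v≢x v≢y))
              in z , v-z , T⊆T′ z∈T
              where
              v≢y : v ≢ y
              v≢y refl = D∉S Dv y∈S
            by-cases (yes refl) with Maybe.≡-dec _≟_ (partner W x) (partner M x)
            ... | yes same = y , trans (≡.sym same) x-y , y∈T′ same
            ... | no other = let (z , x-z , z∈T) = moved x Dx other in z , x-z , T⊆T′ z∈T
          origin′ : y ≡ s₀ ⊎ Covered M y
          origin′ with y ≟ s₀ | partner M y in y-m
          ... | yes y≡s₀ | _      = inj₁ y≡s₀
          ... | no _     | just z = inj₂ (z , refl)
          ... | no y≢s₀  | nothing =
            contradiction (trans (≡.sym (keeps-uncovered y (¬D-S y∈S) y≢s₀ y-m)) (partner-sym W x-y)) λ ()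

    Tips : Subset n → Set
    Tips T = ∀ {r} → r ∈ T → Tip T r

    Stuck : ∀ {T} → Tips T → Set
    Stuck {T} tips = ∀ {r x} (r∈T : r ∈ T) → D x → Adj G r x → IntoS (Tip.W (tips r∈T)) x

    shift-from-tip : ∀ {T r x} (tip : Tip T r) → r ∈ S → D x → Adj G r x → ¬ IntoS (Tip.W tip) x → Shift
    shift-from-tip {x = x} tip r∈S Dx rx ¬into with partner (Tip.W tip) x in x-w
    ... | nothing = switched⇒shift Dx (FromTip.through-free tip r∈S Dx rx x-w)
    ... | just y with y ∈? S
    ...   | yes y∈S = contradiction (y , refl , y∈S) ¬into
    ...   | no  y∉S =
      switched⇒shift (D-closed Dx y∉S (partner-adj (Tip.W tip) x-w)) (FromTip.through-matched tip r∈S Dx rx x-w)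

    shift-or-stuck : ∀ {T} → T ⊆ S → (tips : Tips T) → Shift ⊎ Stuck tips
    shift-or-stuck {T} T⊆S tips with any? (λ r → any? (λ x → open? r x))
      where
      Open : Fin n → Fin n → Set
      Open r x = Σ (r ∈ T) λ r∈T → D x × Adj G r x × ¬ IntoS (Tip.W (tips r∈T)) x
      open? : ∀ r x → Dec (Open r x)
      open? r x with r ∈? T
      ... | no r∉T = no λ (r∈T , _) → r∉T r∈T
      ... | yes r∈T with D? x ×-dec adj? G r x ×-dec ¬? (intoS? (Tip.W (tips r∈T)) x)
      ...   | yes (Dx , rx , ¬into) = yes (r∈T , Dx , rx , ¬into)
      ...   | no  closed = no λ (r∈T′ , Dx , rx , ¬into) →
                closed (Dx , rx , subst (λ r∈T → ¬ IntoS (Tip.W (tips r∈T)) x) ([]=-irrelevant r∈T′ r∈T) ¬into)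
    ... | yes (r , x , r∈T , Dx , rx , ¬into) = inj₁ (shift-from-tip (tips r∈T) (T⊆S r∈T) Dx rx ¬into)
    ... | no none = inj₂ λ {r} {x} r∈T Dx rx →
            decidable-stable (intoS? (Tip.W (tips r∈T)) x) λ ¬into → none (r , x , r∈T , Dx , rx , ¬into)

    Fed : Subset n → Fin n → Set
    Fed T y = y ∈ S × ∃[ x ] ((D x × ∃[ r ] (r ∈ T × Adj G r x)) × partner M x ≡ just y)

    fed? : ∀ T y → Dec (Fed T y)
    fed? T y = y ∈? S ×-dec any? λ x →
      (D? x ×-dec any? (λ r → r ∈? T ×-dec adj? G r x)) ×-dec Maybe.≡-dec _≟_ (partner M x) (just y)

    explore? : ∀ T y → Dec (y ∈ T ⊎ Fed T y)
    explore? T y = y ∈? T ⊎-dec fed? T y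

    explore : Subset n → Subset n
    explore T = toSubset (explore? T)

    explore-inflationary : ∀ T → T ⊆ explore T
    explore-inflationary T r∈T = ∈toSubset⁺ (explore? T) (inj₁ r∈T)

    explore-tips : ∀ {T} → T ⊆ S → (tips : Tips T) → Stuck tips → Tips (explore T)
    explore-tips {T} T⊆S tips stuck {y} y∈ with ∈toSubset⁻ (explore? T) y∈
    ... | inj₁ y∈T = tip-mono (explore-inflationary T) (tips y∈T)
    ... | inj₂ (y∈S , x , (Dx , r , r∈T , rx) , x-y) with stuck r∈T Dx rx
    ...   | y′ , x-y′ , y′∈S with Maybe.≡-dec _≟_ (partner (Tip.W (tips r∈T)) x) (partner M x)
    ...     | yes same with just-injective (trans (≡.sym x-y′) (trans same x-y))
    ...       | refl = FromTip.next-tip (tips r∈T) (T⊆S r∈T) Dx rx x-y′ y∈S (explore-inflationary T) (λ _ → y∈)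
    explore-tips {T} T⊆S tips stuck {y} y∈ | inj₂ (y∈S , x , (Dx , r , r∈T , rx) , x-y) | y′ , x-y′ , y′∈S | no other
      with Tip.moved (tips r∈T) x Dx other
    ... | z , x-z , z∈T with just-injective (trans (≡.sym x-z) x-y)
    ...   | refl = tip-mono (explore-inflationary T) (tips z∈T)

    Explored : Subset n → Set
    Explored T = s₀ ∈ T × T ⊆ S × Tips T

    explored₀ : Explored (toSubset (_≟ s₀))
    explored₀ = ∈toSubset⁺ (_≟ s₀) refl , (λ r∈ → subst (_∈ S) (≡.sym (∈toSubset⁻ (_≟ s₀) r∈)) s₀∈S) ,
                tips₀
      where
      tips₀ : Tips (toSubset (_≟ s₀))
      tips₀ r∈ with ∈toSubset⁻ (_≟ s₀) r∈
      ... | refl = tip₀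

    explore-step : ∀ {T} → Explored T → Shift ⊎ Explored (explore T)
    explore-step {T} (s₀∈T , T⊆S , tips) with shift-or-stuck T⊆S tips
    ... | inj₁ shift = inj₁ shift
    ... | inj₂ stuck = inj₂ (explore-inflationary T s₀∈T , explore⊆S , explore-tips T⊆S tips stuck)
      where
      explore⊆S : explore T ⊆ S
      explore⊆S y∈ with ∈toSubset⁻ (explore? T) y∈
      ... | inj₁ y∈T       = T⊆S y∈T
      ... | inj₂ (y∈S , _) = y∈S

    -- When no tip extends into D, (S ∖ C) together with the D-neighbours of C separates D from the
    -- rest of G − S, and M matches those D-neighbours injectively into C ∖ {s₀}: fewer than k vertices.
    module Separation {C : Subset n} (closed : explore C ⊆ C) (s₀∈C : s₀ ∈ C) (C⊆S : C ⊆ S)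
      (tips : Tips C) (stuck : Stuck tips) where

      D-neighbour-matched-into-C : ∀ {r x} → r ∈ C → D x → Adj G r x → ∃[ z ] (partner M x ≡ just z × z ∈ C)
      D-neighbour-matched-into-C {r} {x} r∈C Dx rx with stuck r∈C Dx rx
      ... | y , x-y , y∈S with Maybe.≡-dec _≟_ (partner (Tip.W (tips r∈C)) x) (partner M x)
      ...   | yes same = y , trans (≡.sym same) x-y ,
                         closed (∈toSubset⁺ (explore? C) (inj₂ (y∈S , x , (Dx , r , r∈C , rx) , trans (≡.sym same) x-y)))
      ...   | no other = Tip.moved (tips r∈C) x Dx other

      Separator : Fin n → Set
      Separator x = (x ∈ S × x ∉ C) ⊎ (D x × ∃[ r ] (r ∈ C × Adj G r x))

      separator? : Decidable Separator
      separator? x = (x ∈? S ×-dec ¬? (x ∈? C)) ⊎-dec (D? x ×-dec any? (λ r → r ∈? C ×-dec adj? G r x))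

      X : Subset n
      X = toSubset separator?

      ∣X∣<k : ∣ X ∣ < k
      ∣X∣<k = begin-strict
        ∣ X ∣                                 ≡⟨ ∣toSubset∣≡count separator? ⟩
        count separator?                      ≤⟨ count-∪ S∖C? D-nbr? separator? (λ sep → sep) ⟩
        count S∖C? + count D-nbr?             ≤⟨ +-monoʳ-≤ (count S∖C?) D-nbr≤C∖s₀ ⟩
        count S∖C? + count C∖s₀?              <⟨ +-monoʳ-< (count S∖C?) C∖s₀<C ⟩
        count S∖C? + count (_∈? C)            ≡⟨ +-comm (count S∖C?) _ ⟩
        count (_∈? C) + count S∖C?            ≡⟨ cong (_+ count S∖C?) C≡S∩C ⟩
        count S∩C? + count S∖C?               ≡⟨ count-split (_∈? S) (_∈? C) ⟨
        count (_∈? S)                         ≡⟨ ∣p∣≡count∈ S ⟨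
        ∣ S ∣                                 ≡⟨ ∣S∣≡k ⟩
        k                                     ∎
        where
        open ≤-Reasoning
        S∖C? : Decidable (λ x → x ∈ S × x ∉ C)
        S∖C? x = x ∈? S ×-dec ¬? (x ∈? C)
        S∩C? : Decidable (λ x → x ∈ S × x ∈ C)
        S∩C? x = x ∈? S ×-dec x ∈? C
        D-nbr? : Decidable (λ x → D x × ∃[ r ] (r ∈ C × Adj G r x))
        D-nbr? x = D? x ×-dec any? (λ r → r ∈? C ×-dec adj? G r x)
        C∖s₀? : Decidable (λ x → x ∈ C × x ≢ s₀)
        C∖s₀? x = x ∈? C ×-dec ¬? (x ≟ s₀)
        C≡S∩C : count (_∈? C) ≡ count S∩C?
        C≡S∩C = count-cong (_∈? C) S∩C? (λ r∈C → C⊆S r∈C , r∈C) proj₂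
        D-nbr≤C∖s₀ : count D-nbr? ≤ count C∖s₀?
        D-nbr≤C∖s₀ = count-mono-involution D-nbr? C∖s₀? (mate M) (mate-involutive M) λ (Dx , r , r∈C , rx) →
          let (z , x-z , z∈C) = D-neighbour-matched-into-C r∈C Dx rx in
          subst (λ w → w ∈ C × w ≢ s₀) (≡.sym (mate-just M x-z))
                (z∈C , λ z≡s₀ → uncovered⇒¬Covered M s₀-free (subst (Covered M) z≡s₀ (_ , partner-sym M x-z)))
        C∖s₀<C : suc (count C∖s₀?) ≤ count (_∈? C)
        C∖s₀<C = count-mono-< C∖s₀? (_∈? C) proj₁ s₀∈C (λ (_ , s₀≢s₀) → s₀≢s₀ refl)

      separates : ∀ {f g} → D f → ¬ IntoS M f → g ∉ S → ¬ D g → ⊥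
      separates {f} {g} Df f-not-into-S g∉S ¬Dg = escape Df (connected X ∣X∣<k f g f∉X g∉X)
        where
        f∉X : f ∉ X
        f∉X f∈X with ∈toSubset⁻ separator? f∈X
        ... | inj₁ (f∈S , _)          = D∉S Df f∈S
        ... | inj₂ (_ , r , r∈C , rf) =
          let (z , f-z , z∈C) = D-neighbour-matched-into-C r∈C Df rf in f-not-into-S (z , f-z , C⊆S z∈C)
        g∉X : g ∉ X
        g∉X g∈X with ∈toSubset⁻ separator? g∈X
        ... | inj₁ (g∈S , _) = g∉S g∈S
        ... | inj₂ (Dg , _)  = ¬Dg Dg
        escape : ∀ {w} → D w → Reach G X w g → ⊥
        escape Dw (here _) = ¬Dg Dw
        escape Dw (step {v = w′} w∉X ww′ rest) with w′ ∈? S | w′ ∈? C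
        ... | no  w′∉S | _        = escape (D-closed Dw w′∉S ww′) rest
        ... | yes _    | yes w′∈C = w∉X (∈toSubset⁺ separator? (inj₂ (Dw , w′ , w′∈C , sym G ww′)))
        ... | yes w′∈S | no  w′∉C = reach-source∉ G rest (∈toSubset⁺ separator? (inj₁ (w′∈S , w′∉C)))

    -- Abstract: unfolding this proof term during later conversion checks is prohibitively expensive.
    abstract
      shift-exists : ∀ {f g} → D f → ¬ IntoS M f → g ∉ S → ¬ D g → Shift
      shift-exists Df f-not-into-S g∉S ¬Dg
        with closure-induction explore explore-inflationary Explored explore-step explored₀
      ... | inj₁ shift = shift
      ... | inj₂ (C , closed , s₀∈C , C⊆S , tips) with shift-or-stuck C⊆S tips
      ...   | inj₁ shift = shift
      ...   | inj₂ stuck = ⊥-elim (Separation.separates closed s₀∈C C⊆S tips stuck Df f-not-into-S g∉S ¬Dg)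

-- At most two components

module _ {n : ℕ} (G : Graph n) {k : ℕ} (S : Subset n) (∣S∣≡k : ∣ S ∣ ≡ k) (large : 2 * k + 3 ≤ n)
  (connected : ∀ X → ∣ X ∣ < k → ConnectedMinus G X) where

  open VertexCut G S ∣S∣≡k connected

  all-but-two-into-S : (N : Matching G) {u d : Fin n} → (∀ {x} → x ∉ S → x ≢ u → x ≢ d → IntoS N x) → ⊥
  all-but-two-into-S N {u} {d} into =
    contradiction large (<⇒≱ (subst (n <_) (≡.sym (+-suc (2 * k) 2)) (s≤s n≤2k+2)))
    where
    open ≤-Reasoning
    rest? : Decidable (λ x → x ∉ S × x ≢ u × x ≢ d)
    rest? x = ¬? (x ∈? S) ×-dec ¬? (x ≟ u) ×-dec ¬? (x ≟ d)
    u-or-d? : Decidable (λ x → x ≡ u ⊎ x ≡ d)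
    u-or-d? x = x ≟ u ⊎-dec x ≟ d
    ∣S∣≡count : count (_∈? S) ≡ k
    ∣S∣≡count = trans (≡.sym (∣p∣≡count∈ S)) ∣S∣≡k
    rest≤k : count rest? ≤ k
    rest≤k = ≤-trans (count-mono-involution rest? (_∈? S) (mate N) (mate-involutive N) mate∈S) (≤-reflexive ∣S∣≡count)
      where
      mate∈S : ∀ {x} → x ∉ S × x ≢ u × x ≢ d → mate N x ∈ S
      mate∈S (x∉S , x≢u , x≢d) =
        let (y , x-y , y∈S) = into x∉S x≢u x≢d in subst (_∈ S) (≡.sym (mate-just N x-y)) y∈S
    u-or-d≤2 : count u-or-d? ≤ 2
    u-or-d≤2 = ≤-trans (count-∪ (_≟ u) (_≟ d) u-or-d? id)
                       (+-mono-≤ (count-subsingleton (_≟ u) λ p q → trans p (≡.sym q))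
                                 (count-subsingleton (_≟ d) λ p q → trans p (≡.sym q)))
    split : ∀ {x} → x ∉ S → (x ∉ S × x ≢ u × x ≢ d) ⊎ (x ≡ u ⊎ x ≡ d)
    split {x} x∉S with x ≟ u | x ≟ d
    ... | yes x≡u | _       = inj₂ (inj₁ x≡u)
    ... | no _    | yes x≡d = inj₂ (inj₂ x≡d)
    ... | no x≢u  | no x≢d  = inj₁ (x∉S , x≢u , x≢d)
    n≤2k+2 : n ≤ 2 * k + 2
    n≤2k+2 = begin
      n                                              ≡⟨ count-∁ (_∈? S) ⟨
      count (_∈? S) + count (λ x → ¬? (x ∈? S))
        ≤⟨ +-monoʳ-≤ _ (count-∪ rest? u-or-d? (λ x → ¬? (x ∈? S)) split) ⟩
      count (_∈? S) + (count rest? + count u-or-d?)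
        ≤⟨ +-mono-≤ (≤-reflexive ∣S∣≡count) (+-mono-≤ rest≤k u-or-d≤2) ⟩
      k + (k + 2)                                    ≡⟨ ≡.sym (+-assoc k k 2) ⟩
      k + k + 2                                      ≡⟨ cong (λ m → k + m + 2) (≡.sym (+-identityʳ k)) ⟩
      2 * k + 2                                      ∎

  module NoThreeComponents (2≤k : 2 ≤ k) (equimatchable : Equimatchable G) (factor-critical : FactorCritical G)
    {a b c : Fin n} (a∉S : a ∉ S) (b∉S : b ∉ S) (c∉S : c ∉ S)
    (a≁b : ¬ a ~ b) (a≁c : ¬ a ~ c) (b≁c : ¬ b ~ c) where

    M : Matching G
    M = proj₁ (factor-critical a)

    M-a : partner M a ≡ nothing
    M-a = proj₁ (proj₂ (factor-critical a))

    M-covers : ∀ {u} → u ≢ a → Covered M u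
    M-covers = proj₂ (proj₂ (factor-critical a)) _

    module _ {s₁ u : Fin n} (s₁∈S : s₁ ∈ S) (s₁-u : partner M s₁ ≡ just u) (u∉S : u ∉ S) (a≁u : ¬ a ~ u) where

      private
        Elsewhere : Fin n → Set
        Elsewhere x = x ∉ S × ¬ a ~ x × ¬ u ~ x

        elsewhere? : Decidable Elsewhere
        elsewhere? x = ¬? (x ∈? S) ×-dec ¬? (reach? G a x) ×-dec ¬? (reach? G u x)

        elsewhere-closed : ∀ {x y} → Elsewhere x → y ∉ S → Adj G x y → Elsewhere y
        elsewhere-closed (x∉S , a≁x , u≁x) y∉S xy =
          y∉S , (λ a~y → a≁x (~-edge a~y y∉S (sym G xy) x∉S)) , (λ u~y → u≁x (~-edge u~y y∉S (sym G xy) x∉S))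

        M₀ : Matching G
        M₀ = unmatch M s₁

        M₀-covers : ∀ {y} → y ≢ s₁ → y ≢ u → y ≢ a → Covered M₀ y
        M₀-covers y≢s₁ y≢u y≢a = let (w , y-w) = M-covers y≢a in w , trans (unmatch-≢ M s₁-u y≢s₁ y≢u) y-w

        a≢u : a ≢ u
        a≢u = ≁⇒≢ a∉S a≁u

        open AlternatingPaths Elsewhere elsewhere? proj₁ elsewhere-closed M₀ s₁∈S (unmatch-self M s₁)

        shift-strands-a-and-u : Shift → ⊥
        shift-strands-a-and-u shift =
          no-two-stranded equimatchable factor-critical N a≢u (a-free , a-neighbours) (u-free , u-neighbours)
          where
          open Shift shift renaming (matching to N)

          a-free : partner N a ≡ nothing
          a-free = trans (agrees-off-D a a∉S (λ (_ , a≁a , _) → a≁a (here a∉S)))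
                         (trans (unmatch-≢ M s₁-u (∉≢∈ a∉S s₁∈S) a≢u) M-a)
          u-free : partner N u ≡ nothing
          u-free = trans (agrees-off-D u u∉S (λ (_ , _ , u≁u) → u≁u (here u∉S))) (unmatch-mate M s₁-u)

          N-covers : ∀ {y} → ¬ Elsewhere y → y ≢ a → y ≢ u → Covered N y
          N-covers {y} ¬Ey y≢a y≢u with y ≟ s₁
          ... | yes y≡s₁ = keeps-covered y ¬Ey (inj₁ y≡s₁)
          ... | no  y≢s₁ = keeps-covered y ¬Ey (inj₂ (M₀-covers y≢s₁ y≢u y≢a))

          a-neighbours : ∀ {y} → Adj G a y → Covered N y
          a-neighbours {y} ay with y ∈? S
          ... | yes y∈S = N-covers (λ (y∉S , _) → y∉S y∈S) (∈≢∉ y∈S a∉S) (∈≢∉ y∈S u∉S)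
          ... | no  y∉S = N-covers (λ (_ , a≁y , _) → a≁y a~y) (λ { refl → irrefl G ay }) (λ { refl → a≁u a~y })
            where a~y = reach-edge G a∉S y∉S ay

          u-neighbours : ∀ {y} → Adj G u y → Covered N y
          u-neighbours {y} uy with y ∈? S
          ... | yes y∈S = N-covers (λ (y∉S , _) → y∉S y∈S) (∈≢∉ y∈S a∉S) (∈≢∉ y∈S u∉S)
          ... | no  y∉S =
            N-covers (λ (_ , _ , u≁y) → u≁y u~y) (λ { refl → a≁u (reach-sym G u~y) }) (λ { refl → irrefl G uy })
            where u~y = reach-edge G u∉S y∉S uy

      abstract
        off-both-sides-matched-into-S : ∀ {f} → f ∉ S → ¬ a ~ f → ¬ u ~ f → IntoS M f
        off-both-sides-matched-into-S {f} f∉S a≁f u≁f = decidable-stable (intoS? M f) λ ¬into →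
          shift-strands-a-and-u (shift-exists (f∉S , a≁f , u≁f)
            (λ (y , f-y , y∈S) → ¬into (y , release-⊆ M (_≟ s₁) f y f-y , y∈S))
            a∉S (λ (_ , a≁a , _) → a≁a (here a∉S)))

    module _ {s₁ u d : Fin n} (s₁∈S : s₁ ∈ S) (s₁-u : partner M s₁ ≡ just u) (u∉S : u ∉ S) (a≁u : ¬ a ~ u)
      (d∉S : d ∉ S) (a≁d : ¬ a ~ d) (u≁d : ¬ u ~ d) where

      private
        d-into-S : IntoS M d
        d-into-S = off-both-sides-matched-into-S s₁∈S s₁-u u∉S a≁u d∉S a≁d u≁d

        s₂ : Fin n
        s₂ = proj₁ d-into-S

        s₂-d : partner M s₂ ≡ just d
        s₂-d = partner-sym M (proj₁ (proj₂ d-into-S))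

        s₂∈S : s₂ ∈ S
        s₂∈S = proj₂ (proj₂ d-into-S)

        u≢d : u ≢ d
        u≢d = ≁⇒≢ u∉S u≁d

        s₂≢s₁ : s₂ ≢ s₁
        s₂≢s₁ s₂≡s₁ = u≢d (just-injective (trans (≡.sym s₁-u) (subst (λ s → partner M s ≡ just d) s₂≡s₁ s₂-d)))

        off-a-side-matched-into-S : ∀ {f} → f ∉ S → ¬ a ~ f → IntoS M f
        off-a-side-matched-into-S {f} f∉S a≁f with reach? G u f
        ... | no  u≁f = off-both-sides-matched-into-S s₁∈S s₁-u u∉S a≁u f∉S a≁f u≁f
        ... | yes u~f = off-both-sides-matched-into-S s₂∈S s₂-d d∉S a≁d f∉S a≁f
                          (λ d~f → u≁d (reach-trans G u~f (reach-sym G d~f)))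

        Freed : Fin n → Set
        Freed x = x ≡ s₁ ⊎ x ≡ s₂

        freed? : Decidable Freed
        freed? x = x ≟ s₁ ⊎-dec x ≟ s₂

        N₀ : Matching G
        N₀ = release M freed?

        N₀-agrees : ∀ {x} → x ≢ s₁ → x ≢ u → x ≢ s₂ → x ≢ d → partner N₀ x ≡ partner M x
        N₀-agrees x≢s₁ x≢u x≢s₂ x≢d = release-other M freed? [ x≢s₁ , x≢s₂ ] λ where
          (_ , x-s , inj₁ refl) → x≢u (just-injective (trans (≡.sym (partner-sym M x-s)) s₁-u))
          (_ , x-s , inj₂ refl) → x≢d (just-injective (trans (≡.sym (partner-sym M x-s)) s₂-d))

        N₀-covers : ∀ {y} → y ≢ s₁ → y ≢ u → y ≢ s₂ → y ≢ d → y ≢ a → Covered N₀ y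
        N₀-covers y≢s₁ y≢u y≢s₂ y≢d y≢a =
          let (w , y-w) = M-covers y≢a in w , trans (N₀-agrees y≢s₁ y≢u y≢s₂ y≢d) y-w

        ASide : Fin n → Set
        ASide x = x ∉ S × a ~ x

        aSide? : Decidable ASide
        aSide? x = ¬? (x ∈? S) ×-dec reach? G a x

        aSide-closed : ∀ {x y} → ASide x → y ∉ S → Adj G x y → ASide y
        aSide-closed (x∉S , a~x) y∉S xy = y∉S , ~-edge a~x x∉S xy y∉S

        ¬ASide-S : ∀ {x} → x ∈ S → ¬ ASide x
        ¬ASide-S x∈S (x∉S , _) = x∉S x∈S

        module P₁ = AlternatingPaths ASide aSide? proj₁ aSide-closed N₀ s₁∈S (release-touched M freed? (inj₁ refl))

        shift₁ : P₁.Shift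
        shift₁ = P₁.shift-exists (a∉S , here a∉S) (λ (_ , a-y , _) → contradiction (trans (≡.sym N₀-a) a-y) λ ())
                   u∉S (λ (_ , a~u) → a≁u a~u)
          where
          N₀-a : partner N₀ a ≡ nothing
          N₀-a = trans (N₀-agrees (∉≢∈ a∉S s₁∈S) (≁⇒≢ a∉S a≁u) (∉≢∈ a∉S s₂∈S) (≁⇒≢ a∉S a≁d)) M-a

        N₁ : Matching G
        N₁ = P₁.Shift.matching shift₁

        N₁-s₂ : partner N₁ s₂ ≡ nothing
        N₁-s₂ = P₁.Shift.keeps-uncovered shift₁ s₂ (¬ASide-S s₂∈S) s₂≢s₁ (release-touched M freed? (inj₂ refl))

        module P₂ = AlternatingPaths ASide aSide? proj₁ aSide-closed N₁ s₂∈S N₁-s₂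

        second-shift-strands-u-and-d : P₂.Shift → ⊥
        second-shift-strands-u-and-d shift₂ = no-two-stranded equimatchable factor-critical N₂ u≢d
          (free u∉S a≁u (release-mate M freed? (inj₁ refl) s₁-u) ,
           neighbours u∉S a≁u λ uy _ u~y → (λ { refl → irrefl G uy }) , (λ { refl → u≁d u~y }))
          (free d∉S a≁d (release-mate M freed? (inj₂ refl) s₂-d) ,
           neighbours d∉S a≁d λ dy _ d~y → (λ { refl → u≁d (reach-sym G d~y) }) , (λ { refl → irrefl G dy }))
          where
          open P₂.Shift shift₂ renaming (matching to N₂)

          free : ∀ {w} → w ∉ S → ¬ a ~ w → partner N₀ w ≡ nothing → partner N₂ w ≡ nothing
          free w∉S a≁w w-free = trans (agrees-off-D _ w∉S (λ (_ , a~w) → a≁w a~w))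
                                  (trans (P₁.Shift.agrees-off-D shift₁ _ w∉S (λ (_ , a~w) → a≁w a~w)) w-free)

          N₂-covers : ∀ {y} → ¬ ASide y → y ≢ u → y ≢ d → y ≢ a → Covered N₂ y
          N₂-covers {y} ¬Ay y≢u y≢d y≢a with y ≟ s₂ | y ≟ s₁
          ... | yes y≡s₂ | _        = keeps-covered y ¬Ay (inj₁ y≡s₂)
          ... | no _     | yes y≡s₁ = keeps-covered y ¬Ay (inj₂ (P₁.Shift.keeps-covered shift₁ y ¬Ay (inj₁ y≡s₁)))
          ... | no y≢s₂  | no y≢s₁  =
            keeps-covered y ¬Ay (inj₂ (P₁.Shift.keeps-covered shift₁ y ¬Ay
              (inj₂ (N₀-covers y≢s₁ y≢u y≢s₂ y≢d y≢a))))

          neighbours : ∀ {w} → w ∉ S → ¬ a ~ w → (∀ {y} → Adj G w y → y ∉ S → w ~ y → y ≢ u × y ≢ d) →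
            ∀ {y} → Adj G w y → Covered N₂ y
          neighbours w∉S a≁w distinct {y} wy with y ∈? S
          ... | yes y∈S = N₂-covers (¬ASide-S y∈S) (∈≢∉ y∈S u∉S) (∈≢∉ y∈S d∉S) (∈≢∉ y∈S a∉S)
          ... | no  y∉S = N₂-covers (λ (_ , a~y) → a≁w (reach-trans G a~y (reach-sym G w~y)))
                            (proj₁ (distinct wy y∉S w~y)) (proj₂ (distinct wy y∉S w~y))
                            (λ { refl → a≁w (reach-sym G w~y) })
            where w~y = reach-edge G w∉S y∉S wy

      mate-off-a-side-impossible : ⊥
      mate-off-a-side-impossible with any? (λ x → aSide? x ×-dec ¬? (intoS? N₁ x))
      ... | yes (x , (x∉S , a~x) , ¬into) = second-shift-strands-u-and-d
              (P₂.shift-exists (x∉S , a~x) ¬into u∉S (λ (_ , a~u) → a≁u a~u))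
      ... | no none = all-but-two-into-S N₁ into
        where
        into : ∀ {x} → x ∉ S → x ≢ u → x ≢ d → IntoS N₁ x
        into {x} x∉S x≢u x≢d with reach? G a x
        ... | yes a~x = decidable-stable (intoS? N₁ x) λ ¬into → none (x , (x∉S , a~x) , ¬into)
        ... | no  a≁x =
          let (y , x-y , y∈S) = off-a-side-matched-into-S x∉S a≁x in
          y , trans (P₁.Shift.agrees-off-D shift₁ x x∉S (λ (_ , a~x) → a≁x a~x))
                    (trans (N₀-agrees (∉≢∈ x∉S s₁∈S) x≢u (∉≢∈ x∉S s₂∈S) x≢d) x-y) , y∈S

    module _ (mates-on-a-side : ∀ {s w} → s ∈ S → partner M s ≡ just w → w ∉ S → a ~ w) where

      module _ {σ₁ σ₂ : Fin n} (σ₁∈S : σ₁ ∈ S) (σ₂∈S : σ₂ ∈ S) (σ₁≢σ₂ : σ₁ ≢ σ₂)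
        (σ₁-mate : ∀ {w} → partner M σ₁ ≡ just w → a ~ w ⊎ w ≡ σ₂)
        (σ₂-mate : ∀ {w} → partner M σ₂ ≡ just w → a ~ w ⊎ w ≡ σ₁) where

        private
          b-neighbour : ∃[ x ] (b ~ x × Adj G σ₁ x)
          b-neighbour = neighbour-in-component σ₁∈S b∉S a∉S (a≁b ∘ reach-sym G)

          c-neighbour : ∃[ x ] (c ~ x × Adj G σ₂ x)
          c-neighbour = neighbour-in-component σ₂∈S c∉S a∉S (a≁c ∘ reach-sym G)

          x₁ : Fin n
          x₁ = proj₁ b-neighbour

          b~x₁ : b ~ x₁
          b~x₁ = proj₁ (proj₂ b-neighbour)

          σ₁x₁ : Adj G σ₁ x₁
          σ₁x₁ = proj₂ (proj₂ b-neighbour)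

          x₂ : Fin n
          x₂ = proj₁ c-neighbour

          c~x₂ : c ~ x₂
          c~x₂ = proj₁ (proj₂ c-neighbour)

          σ₂x₂ : Adj G σ₂ x₂
          σ₂x₂ = proj₂ (proj₂ c-neighbour)

          x₁∉S : x₁ ∉ S
          x₁∉S = reach-target∉ G b~x₁

          x₂∉S : x₂ ∉ S
          x₂∉S = reach-target∉ G c~x₂

          apart : ∀ {x y} → b ~ x → c ~ y → x ≢ y
          apart b~x c~y refl = b≁c (reach-trans G b~x (reach-sym G c~y))

          x₁≢a : x₁ ≢ a
          x₁≢a x₁≡a = a≁b (reach-sym G (subst (b ~_) x₁≡a b~x₁))

          x₂≢a : x₂ ≢ a
          x₂≢a x₂≡a = a≁c (reach-sym G (subst (c ~_) x₂≡a c~x₂))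

          y₁ : Fin n
          y₁ = proj₁ (M-covers x₁≢a)

          x₁-y₁ : partner M x₁ ≡ just y₁
          x₁-y₁ = proj₂ (M-covers x₁≢a)

          y₂ : Fin n
          y₂ = proj₁ (M-covers x₂≢a)

          x₂-y₂ : partner M x₂ ≡ just y₂
          x₂-y₂ = proj₂ (M-covers x₂≢a)

          y₁∉S : y₁ ∉ S
          y₁∉S y₁∈S = a≁b (reach-trans G (mates-on-a-side y₁∈S (partner-sym M x₁-y₁) x₁∉S) (reach-sym G b~x₁))

          y₂∉S : y₂ ∉ S
          y₂∉S y₂∈S = a≁c (reach-trans G (mates-on-a-side y₂∈S (partner-sym M x₂-y₂) x₂∉S) (reach-sym G c~x₂))

          b~y₁ : b ~ y₁
          b~y₁ = ~-edge b~x₁ x₁∉S (partner-adj M x₁-y₁) y₁∉S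

          c~y₂ : c ~ y₂
          c~y₂ = ~-edge c~x₂ x₂∉S (partner-adj M x₂-y₂) y₂∉S

          Released : Fin n → Set
          Released x = x ≡ σ₁ ⊎ x ≡ σ₂ ⊎ x ≡ x₁ ⊎ x ≡ x₂

          released? : Decidable Released
          released? x = x ≟ σ₁ ⊎-dec x ≟ σ₂ ⊎-dec x ≟ x₁ ⊎-dec x ≟ x₂

          U : Matching G
          U = release M released?

          U-σ₁ : partner U σ₁ ≡ nothing
          U-σ₁ = release-touched M released? (inj₁ refl)

          U-x₁ : partner U x₁ ≡ nothing
          U-x₁ = release-touched M released? (inj₂ (inj₂ (inj₁ refl)))

          N₁ : Matching G
          N₁ = match U U-σ₁ U-x₁ σ₁x₁

          N₁-σ₂ : partner N₁ σ₂ ≡ nothing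
          N₁-σ₂ = trans (match-other U U-σ₁ U-x₁ σ₁x₁ (σ₁≢σ₂ ∘ ≡.sym) (∈≢∉ σ₂∈S x₁∉S))
                        (release-touched M released? (inj₂ (inj₁ refl)))

          N₁-x₂ : partner N₁ x₂ ≡ nothing
          N₁-x₂ = trans (match-other U U-σ₁ U-x₁ σ₁x₁ (∉≢∈ x₂∉S σ₁∈S) (apart b~x₁ c~x₂ ∘ ≡.sym))
                        (release-touched M released? (inj₂ (inj₂ (inj₂ refl))))

          N : Matching G
          N = match N₁ N₁-σ₂ N₁-x₂ σ₂x₂

          N₁⊆N : _⊆ᴹ_ G N₁ N
          N₁⊆N = match-⊇ N₁ N₁-σ₂ N₁-x₂ σ₂x₂

          U⊆N : _⊆ᴹ_ G U N
          U⊆N = ⊆ᴹ-trans {M = U} {N₁} {N} (match-⊇ U U-σ₁ U-x₁ σ₁x₁) N₁⊆N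

          released-covered : ∀ {y} → Released y → Covered N y
          released-covered (inj₁ refl)               = ⊆ᴹ-covered {M = N₁} {N} N₁⊆N (x₁ , match-left U U-σ₁ U-x₁ σ₁x₁)
          released-covered (inj₂ (inj₁ refl))        = x₂ , match-left N₁ N₁-σ₂ N₁-x₂ σ₂x₂
          released-covered (inj₂ (inj₂ (inj₁ refl))) = ⊆ᴹ-covered {M = N₁} {N} N₁⊆N (σ₁ , match-right U U-σ₁ U-x₁ σ₁x₁)
          released-covered (inj₂ (inj₂ (inj₂ refl))) = σ₂ , match-right N₁ N₁-σ₂ N₁-x₂ σ₂x₂

          N-uncovered : ∀ {y} → partner N y ≡ nothing → y ≡ a ⊎ a ~ y ⊎ y ≡ y₁ ⊎ y ≡ y₂
          N-uncovered {y} y-free with released? y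
          ... | yes released = contradiction (released-covered released) (uncovered⇒¬Covered N y-free)
          ... | no  kept with release-uncovered M released? (⊆ᴹ-uncovered {M = U} {N} U⊆N y-free)
          ...   | inj₁ y-free′ = inj₁ (decidable-stable (y ≟ a) λ y≢a → uncovered⇒¬Covered M y-free′ (M-covers y≢a))
          ...   | inj₂ (inj₁ released) = contradiction released kept
          ...   | inj₂ (inj₂ (s , y-s , inj₁ refl)) with σ₁-mate (partner-sym M y-s)
          ...     | inj₁ a~y  = inj₂ (inj₁ a~y)
          ...     | inj₂ y≡σ₂ = contradiction (inj₂ (inj₁ y≡σ₂)) kept
          N-uncovered {y} y-free | no kept | inj₂ (inj₂ (s , y-s , inj₂ (inj₁ refl))) with σ₂-mate (partner-sym M y-s)
          ...     | inj₁ a~y  = inj₂ (inj₁ a~y)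
          ...     | inj₂ y≡σ₁ = contradiction (inj₁ y≡σ₁) kept
          N-uncovered {y} y-free | no kept | inj₂ (inj₂ (s , y-s , inj₂ (inj₂ (inj₁ refl)))) =
            inj₂ (inj₂ (inj₁ (just-injective (trans (≡.sym (partner-sym M y-s)) x₁-y₁))))
          N-uncovered {y} y-free | no kept | inj₂ (inj₂ (s , y-s , inj₂ (inj₂ (inj₂ refl)))) =
            inj₂ (inj₂ (inj₂ (just-injective (trans (≡.sym (partner-sym M y-s)) x₂-y₂))))

          N-free : ∀ {x y} → Released x → partner M x ≡ just y →
            y ≢ σ₁ → y ≢ x₁ → y ≢ σ₂ → y ≢ x₂ → partner N y ≡ nothing
          N-free released x-y y≢σ₁ y≢x₁ y≢σ₂ y≢x₂ =
            trans (match-other N₁ N₁-σ₂ N₁-x₂ σ₂x₂ y≢σ₂ y≢x₂)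
                  (trans (match-other U U-σ₁ U-x₁ σ₁x₁ y≢σ₁ y≢x₁) (release-mate M released? released x-y))

          stranded : ∀ {e z} → partner N z ≡ nothing → z ∉ S → e ~ z → ¬ a ~ e →
            (∀ {y} → Adj G z y → y ∈ S ⊎ e ~ y → y ≢ y₁ × y ≢ y₂) → Stranded N z
          stranded {e} {z} z-free z∉S e~z a≁e distinct = z-free , λ {y} zy →
            decidable-stable (covered? N y) λ ¬cov →
              refute (side zy) (N-uncovered (¬Covered⇒uncovered N ¬cov)) (distinct zy (side zy))
            where
            side : ∀ {y} → Adj G z y → y ∈ S ⊎ e ~ y
            side {y} zy with y ∈? S
            ... | yes y∈S = inj₁ y∈S
            ... | no  y∉S = inj₂ (~-edge e~z z∉S zy y∉S)
            refute : ∀ {y} → y ∈ S ⊎ e ~ y → y ≡ a ⊎ a ~ y ⊎ y ≡ y₁ ⊎ y ≡ y₂ → y ≢ y₁ × y ≢ y₂ → ⊥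
            refute (inj₁ y∈S) (inj₁ refl)        _             = a∉S y∈S
            refute (inj₂ e~y) (inj₁ refl)        _             = a≁e (reach-sym G e~y)
            refute (inj₁ y∈S) (inj₂ (inj₁ a~y))  _             = reach-target∉ G a~y y∈S
            refute (inj₂ e~y) (inj₂ (inj₁ a~y))  _             = a≁e (reach-trans G a~y (reach-sym G e~y))
            refute _          (inj₂ (inj₂ (inj₁ y≡y₁))) (y≢y₁ , _) = y≢y₁ y≡y₁
            refute _          (inj₂ (inj₂ (inj₂ y≡y₂))) (_ , y≢y₂) = y≢y₂ y≡y₂

        σ-pair-impossible : ⊥
        σ-pair-impossible = no-two-stranded equimatchable factor-critical N (apart b~y₁ c~y₂)
          (stranded N-y₁ y₁∉S b~y₁ a≁b λ y₁y side → (λ { refl → irrefl G y₁y }) ,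
                                                     (λ { refl → [ y₂∉S , (λ b~y₂ → apart b~y₂ c~y₂ refl) ] side }))
          (stranded N-y₂ y₂∉S c~y₂ a≁c λ y₂y side → (λ { refl → [ y₁∉S , (λ c~y₁ → apart b~y₁ c~y₁ refl) ] side }) ,
                                                     (λ { refl → irrefl G y₂y }))
          where
          N-y₁ : partner N y₁ ≡ nothing
          N-y₁ = N-free (inj₂ (inj₂ (inj₁ refl))) x₁-y₁ (∉≢∈ y₁∉S σ₁∈S) (partner-irrefl M x₁-y₁ ∘ ≡.sym)
                   (∉≢∈ y₁∉S σ₂∈S) (apart b~y₁ c~x₂)
          N-y₂ : partner N y₂ ≡ nothing
          N-y₂ = N-free (inj₂ (inj₂ (inj₂ refl))) x₂-y₂ (∉≢∈ y₂∉S σ₁∈S) (apart b~x₁ c~y₂ ∘ ≡.sym)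
                   (∉≢∈ y₂∉S σ₂∈S) (partner-irrefl M x₂-y₂ ∘ ≡.sym)

      mate-in-S-or-on-a-side : ∀ {s} → s ∈ S → ∃[ p ] (partner M s ≡ just p × (p ∈ S ⊎ a ~ p))
      mate-in-S-or-on-a-side {s} s∈S with M-covers (∈≢∉ s∈S a∉S)
      ... | p , s-p with p ∈? S
      ...   | yes p∈S = p , s-p , inj₁ p∈S
      ...   | no  p∉S = p , s-p , inj₂ (mates-on-a-side s∈S s-p p∉S)

      mutual-pair-impossible : ∀ {s p} → s ∈ S → partner M s ≡ just p → p ∈ S → ⊥
      mutual-pair-impossible s∈S s-p p∈S = σ-pair-impossible s∈S p∈S (partner-irrefl M s-p)
        (λ s-w → inj₂ (just-injective (trans (≡.sym s-w) s-p)))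
        (λ p-w → inj₂ (just-injective (trans (≡.sym p-w) (partner-sym M s-p))))

      mates-on-a-side-impossible : ⊥
      mates-on-a-side-impossible
        with count-two⇒∃₂ (_∈? S) (subst (2 ≤_) (trans (≡.sym ∣S∣≡k) (∣p∣≡count∈ S)) 2≤k)
      ... | s₁ , s₂ , s₁∈S , s₂∈S , s₁≢s₂ with mate-in-S-or-on-a-side s₁∈S | mate-in-S-or-on-a-side s₂∈S
      ...   | p₁ , s₁-p₁ , inj₁ p₁∈S | _                      = mutual-pair-impossible s₁∈S s₁-p₁ p₁∈S
      ...   | _                      | p₂ , s₂-p₂ , inj₁ p₂∈S = mutual-pair-impossible s₂∈S s₂-p₂ p₂∈S
      ...   | p₁ , s₁-p₁ , inj₂ a~p₁ | p₂ , s₂-p₂ , inj₂ a~p₂ = σ-pair-impossible s₁∈S s₂∈S s₁≢s₂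
        (λ s₁-w → inj₁ (subst (a ~_) (just-injective (trans (≡.sym s₁-p₁) s₁-w)) a~p₁))
        (λ s₂-w → inj₁ (subst (a ~_) (just-injective (trans (≡.sym s₂-p₂) s₂-w)) a~p₂))

    MateOffASide : Fin n → Set
    MateOffASide s = s ∈ S × ∃[ u ] (partner M s ≡ just u × u ∉ S × ¬ a ~ u)

    mate-off-a-side? : Decidable MateOffASide
    mate-off-a-side? s =
      s ∈? S ×-dec any? λ u → Maybe.≡-dec _≟_ (partner M s) (just u) ×-dec ¬? (u ∈? S) ×-dec ¬? (reach? G a u)

    impossible : ⊥
    impossible with any? mate-off-a-side?
    ... | yes (s₁ , s₁∈S , u , s₁-u , u∉S , a≁u) with reach? G u b
    ...   | no  u≁b = mate-off-a-side-impossible s₁∈S s₁-u u∉S a≁u b∉S a≁b u≁b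
    ...   | yes u~b = mate-off-a-side-impossible s₁∈S s₁-u u∉S a≁u c∉S a≁c
                        (λ u~c → b≁c (reach-trans G (reach-sym G u~b) u~c))
    impossible | no none = mates-on-a-side-impossible (λ {s} {w} s∈S s-w w∉S →
      decidable-stable (reach? G a w) λ a≁w → none (s , s∈S , w , s-w , w∉S , a≁w))

lemma7 : (k n : ℕ) → 2 ≤ k → (G : Graph n) → KConnected G k →
    Equimatchable G → FactorCritical G →
    (S : Subset n) → ∣ S ∣ ≡ k → IsVertexCut G S →
    2 * k + 3 ≤ n → TwoComponents G S
lemma7 k n 2≤k G (_ , connected) equimatchable factor-critical S ∣S∣≡k (a , b , a∉S , b∉S , a≁b) large =
  a , b , a∉S , b∉S , a≁b , joins-a-or-b
  where
  joins-a-or-b : ∀ c → c ∉ S → Reach G S a c ⊎ Reach G S b c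
  joins-a-or-b c c∉S with reach? G a c | reach? G b c
  ... | yes a~c | _       = inj₁ a~c
  ... | no  _   | yes b~c = inj₂ b~c
  ... | no  a≁c | no  b≁c =
    ⊥-elim (NoThreeComponents.impossible G S ∣S∣≡k large connected 2≤k equimatchable factor-critical
              a∉S b∉S c∉S a≁b a≁c b≁c)
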